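{- The logics $\mathbf{K4}$, $\mathbf{KD4}$ and $\mathbf{S4}$ do not enjoy the uniform Lyndon interpolation property. Moreover, if $L$ is a normal modal logic with $\mathbf{K4}\subseteq L\subseteq\mathbf{S4}$, then $L$ does not enjoy the uniform Lyndon interpolation property.
   Context: Formulas are built from countably many propositional variables, $\bot$, $\to$, $\Box$. Positive/negative variable sets: $v^+(p)=\{p\}$, $v^-(p)=\emptyset$; $v^\pm(\bot)=\emptyset$; $v^+(\psi\to\theta)=v^-(\psi)\cup v^+(\theta)$, $v^-(\psi\to\theta)=v^+(\psi)\cup v^-(\theta)$; $v^\pm(\Box\psi)=v^\pm(\psi)$. A normal logic is a set of formulas containing all tautologies and $\Box(p\to q)\to(\Box p\to\Box q)$, closed under modus ponens, necessitation and uniform substitution; $L\vdash\varphi$ means $\varphi\in L$; $\mathbf{K}+X$ is the least normal logic containing $X$. $\mathbf{K4}=\mathbf{K}+\{\Box p\to\Box\Box p\}$, $\mathbf{KD4}=\mathbf{K}+\{\neg\Box\bot,\Box p\to\Box\Box p\}$, $\mathbf{S4}=\mathbf{K}+\{\Box p\to p,\Box p\to\Box\Box p\}$. $L$ has the uniform Lyndon interpolation property if for every formula $\varphi$ and finite sets $P,Q$ of variables there is $\theta$ with $v^+(\theta)\subseteq v^+(\varphi)\setminus P$, $v^-(\theta)\subseteq v^-(\varphi)\setminus Q$, $L\vdash\varphi\to\theta$, and $L\vdash\theta\to\psi$ for every $\psi$ with $v^+(\psi)\cap P=v^-(\psi)\cap Q=\emptyset$ and $L\vdash\varphi\to\psi$.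 -}

module Defs where

open import Data.Nat using (ℕ)
open import Data.Bool using (Bool; true; false; _∨_; not)
open import Data.List using (List; []; _∷_; _++_)
open import Data.List.Membership.Propositional using (_∈_; _∉_)
open import Data.Product using (Σ; _×_; _,_)
open import Relation.Binary.PropositionalEquality using (_≡_)
open import Relation.Nullary using (¬_)

infixr 5 _⇒_
data Fm : Set where
  var : ℕ → Fm
  ⊥'  : Fm
  _⇒_ : Fm → Fm → Fm
  □_  : Fm → Fm

¬' : Fm → Fm
¬' φ = φ ⇒ ⊥'

mutual
  v⁺ : Fm → List ℕ
  v⁺ (var p) = p ∷ []
  v⁺ ⊥' = []
  v⁺ (ψ ⇒ θ) = v⁻ ψ ++ v⁺ θ
  v⁺ (□ ψ) = v⁺ ψ

  v⁻ : Fm → List ℕ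
  v⁻ (var p) = []
  v⁻ ⊥' = []
  v⁻ (ψ ⇒ θ) = v⁺ ψ ++ v⁻ θ
  v⁻ (□ ψ) = v⁻ ψ

eval : (ℕ → Bool) → (Fm → Bool) → Fm → Bool
eval V B (var p) = V p
eval V B ⊥' = false
eval V B (φ ⇒ ψ) = not (eval V B φ) ∨ eval V B ψ
eval V B (□ φ) = B (□ φ)

-- propositional tautologies (substitution instances of classical tautologies)
Tautology : Fm → Set
Tautology φ = ∀ V B → eval V B φ ≡ true

subst : (ℕ → Fm) → Fm → Fm
subst σ (var p) = σ p
subst σ ⊥' = ⊥'
subst σ (φ ⇒ ψ) = subst σ φ ⇒ subst σ ψ
subst σ (□ φ) = □ subst σ φ

axK : Fm
axK = □ (var 0 ⇒ var 1) ⇒ (□ var 0 ⇒ □ var 1)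

Logic : Set₁
Logic = Fm → Set

record IsNormal (L : Logic) : Set where
  field
    taut  : ∀ φ → Tautology φ → L φ
    K     : L axK
    mp    : ∀ φ ψ → L (φ ⇒ ψ) → L φ → L ψ
    nec   : ∀ φ → L φ → L (□ φ)
    usubst : ∀ σ φ → L φ → L (subst σ φ)

_⊆_ : Logic → Logic → Set
L ⊆ M = ∀ φ → L φ → M φ

data K+ (X : Fm → Set) : Fm → Set where
  taut   : ∀ φ → Tautology φ → K+ X φ
  K      : K+ X axK
  ax     : ∀ φ → X φ → K+ X φ
  mp     : ∀ φ ψ → K+ X (φ ⇒ ψ) → K+ X φ → K+ X ψ
  nec    : ∀ φ → K+ X φ → K+ X (□ φ)
  usubst : ∀ σ φ → K+ X φ → K+ X (subst σ φ)

ax4 axT axD : Fm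
ax4 = □ var 0 ⇒ □ □ var 0
axT = □ var 0 ⇒ var 0
axD = ¬' (□ ⊥')

data X-K4 : Fm → Set where
  four : X-K4 ax4

data X-KD4 : Fm → Set where
  d    : X-KD4 axD
  four : X-KD4 ax4

data X-S4 : Fm → Set where
  t    : X-S4 axT
  four : X-S4 ax4

K4 KD4 S4 : Logic
K4  = K+ X-K4
KD4 = K+ X-KD4
S4  = K+ X-S4

_⊢_ : Logic → Fm → Set
L ⊢ φ = L φ

ULIP : Logic → Set
ULIP L =
  (φ : Fm) (P Q : List ℕ) →
  Σ Fm λ θ →
    (∀ x → x ∈ v⁺ θ → (x ∈ v⁺ φ × x ∉ P)) ×
    (∀ x → x ∈ v⁻ θ → (x ∈ v⁻ φ × x ∉ Q)) ×
    (L ⊢ (φ ⇒ θ)) ×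
    (∀ ψ → (∀ x → x ∈ v⁺ ψ → x ∉ P) → (∀ x → x ∈ v⁻ ψ → x ∉ Q) →
       L ⊢ (φ ⇒ ψ) → L ⊢ (θ ⇒ ψ))

-- Let X = (p ∧ q → ◇(p ∧ ¬q)) ∧ (p ∧ ¬q → ◇(p ∧ q)) and φ₀ = p ∧ X ∧ □X. By axiom 4 the
-- conjunct X ∧ □X survives every ◇-step, so K4 proves φ₀ → Alt n for every n, where Alt n
-- says that q alternates along some ◇-path of length n. A uniform Lyndon interpolant θ of φ₀
-- that forgets p mentions only q and has some modal depth k, and L ⊢ θ → Alt (k + 1).
-- Now take the reflexive transitive frame made of a descending chain 0 ← 1 ← 2 ← … whose points
-- alternate in q, and of two-point p-clusters sitting above initial segments of the chain.
-- φ₀ holds on the clusters, and the cluster point above chain point k with the same colour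
-- is k-bisimilar to it for q. So θ holds at chain point k, yet Alt (k + 1) fails there
-- because the chain below it is too short.
-- As the frame validates S4 ⊇ L, this contradicts L ⊢ θ → Alt (k + 1).
module Submission where

open import Defs
open import Data.Bool using (Bool; true; false; T; not; _∧_; _∨_)
open import Data.Bool.Properties using (T-∧; T-≡; ¬-not) renaming (_≟_ to _≟ᵇ_)
open import Data.Empty using (⊥; ⊥-elim)
open import Data.Fin using (Fin; zero; suc)
open import Data.List using (List; []; _∷_; map; downFrom)
open import Data.List.Membership.Propositional using (_∈_; _∉_)
open import Data.List.Membership.Propositional.Properties
  using (∈-++⁺ˡ; ∈-++⁺ʳ; ∈-++⁻; ∈-map⁺; ∈-map⁻; ∈-downFrom⁺; ∈-downFrom⁻)
open import Data.List.Relation.Unary.All as All using (All)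
open import Data.List.Relation.Unary.Any using (here; there)
open import Data.Nat using (ℕ; zero; suc; _+_; _≤_; _<_; _⊔_; _≤?_; _<?_; s≤s)
open import Data.Nat.Properties
  using (≤-refl; ≤-trans; ≤-pred; <⇒≤; ≮⇒≥; n≤1+n; m≤n⇒m<n∨m≡n; m⊔n≤o⇒m≤o; m⊔n≤o⇒n≤o)
open import Data.Product using (_×_; ∃-syntax; _,_; proj₁; proj₂)
open import Data.Sum using (_⊎_; inj₁; inj₂; [_,_])
open import Data.Unit using (tt)
open import Data.Vec using (Vec; []; _∷_; lookup)
import Data.Vec as Vec
open import Data.Vec.Properties using (lookup-map)
open import Function using (_∘_)
open import Function.Bundles using (_⇔_; mk⇔; Equivalence)
import Function.Properties.Equivalence as ⇔
open import Function.Related.TypeIsomorphisms using (→-cong-⇔)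
open import Relation.Binary.PropositionalEquality as ≡ using (_≡_; refl; sym; trans; cong₂)
open import Relation.Nullary using (¬_; Dec; yes; no; does; _because_)
open import Relation.Nullary.Decidable as Dec using (T?; _→-dec_; _×-dec_; from-yes)
open import Relation.Nullary.Reflects using (invert)

variable
  n : ℕ

T-does : {A : Set} (a? : Dec A) → T (does a?) ⇔ A
T-does (true because [a]) = mk⇔ (λ _ → invert [a]) _
T-does (false because [¬a]) = mk⇔ (λ ()) (invert [¬a])

All-cong-⇔ : {W : Set} {P Q : W → Set} {xs : List W} →
             (∀ {x} → P x ⇔ Q x) → All P xs ⇔ All Q xs
All-cong-⇔ P⇔Q = mk⇔ (All.map (Equivalence.to P⇔Q)) (All.map (Equivalence.from P⇔Q))

infixr 7 _∧'_
infixr 6 _∨'_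

⊤' : Fm
⊤' = ¬' ⊥'

_∧'_ _∨'_ : Fm → Fm → Fm
a ∧' b = ¬' (a ⇒ ¬' b)
a ∨' b = ¬' a ⇒ b

◇' : Fm → Fm
◇' a = ¬' (□ ¬' a)

p q : Fm
p = var 0
q = var 1

pq≔ : Fm → Fm → ℕ → Fm
pq≔ a b 0 = a
pq≔ a b 1 = b
pq≔ a b (suc (suc _)) = ⊥'

depth : Fm → ℕ
depth (var x) = 0
depth ⊥' = 0
depth (a ⇒ b) = depth a ⊔ depth b
depth (□ a) = suc (depth a)

data AllVars (P : ℕ → Set) : Fm → Set where
  var : ∀ {x} → P x → AllVars P (var x)
  ⊥'  : AllVars P ⊥'
  _⇒_ : ∀ {a b} → AllVars P a → AllVars P b → AllVars P (a ⇒ b)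
  □_  : ∀ {a} → AllVars P a → AllVars P (□ a)

module _ {P : ℕ → Set} where

  mutual
    AllVars-v⁺ : ∀ {φ} → AllVars P φ → ∀ {x} → x ∈ v⁺ φ → P x
    AllVars-v⁺ (var Px) (here refl) = Px
    AllVars-v⁺ (_⇒_ {a} ha hb) x∈ = [ AllVars-v⁻ ha , AllVars-v⁺ hb ] (∈-++⁻ (v⁻ a) x∈)
    AllVars-v⁺ (□ ha) x∈ = AllVars-v⁺ ha x∈

    AllVars-v⁻ : ∀ {φ} → AllVars P φ → ∀ {x} → x ∈ v⁻ φ → P x
    AllVars-v⁻ (_⇒_ {a} ha hb) x∈ = [ AllVars-v⁺ ha , AllVars-v⁻ hb ] (∈-++⁻ (v⁺ a) x∈)
    AllVars-v⁻ (□ ha) x∈ = AllVars-v⁻ ha x∈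

  occurrences⇒AllVars : ∀ φ → (∀ {x} → x ∈ v⁺ φ → P x) → (∀ {x} → x ∈ v⁻ φ → P x) → AllVars P φ
  occurrences⇒AllVars (var y) h⁺ h⁻ = var (h⁺ (here refl))
  occurrences⇒AllVars ⊥' h⁺ h⁻ = ⊥'
  occurrences⇒AllVars (a ⇒ b) h⁺ h⁻ =
    occurrences⇒AllVars a (λ x∈ → h⁻ (∈-++⁺ˡ x∈)) (λ x∈ → h⁺ (∈-++⁺ˡ x∈)) ⇒
    occurrences⇒AllVars b (λ x∈ → h⁺ (∈-++⁺ʳ (v⁻ a) x∈)) (λ x∈ → h⁻ (∈-++⁺ʳ (v⁺ a) x∈))
  occurrences⇒AllVars (□ a) h⁺ h⁻ = □ occurrences⇒AllVars a h⁺ h⁻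

  allVars? : (∀ x → Dec (P x)) → ∀ φ → Dec (AllVars P φ)
  allVars? P? (var x) = Dec.map′ var (λ { (var Px) → Px }) (P? x)
  allVars? P? ⊥' = yes ⊥'
  allVars? P? (a ⇒ b) =
    Dec.map′ (λ (ha , hb) → ha ⇒ hb) (λ { (ha ⇒ hb) → ha , hb }) (allVars? P? a ×-dec allVars? P? b)
  allVars? P? (□ a) = Dec.map′ □_ (λ { (□ ha) → ha }) (allVars? P? a)

  AllVars-¬ : ∀ {a} → AllVars P a → AllVars P (¬' a)
  AllVars-¬ ha = ha ⇒ ⊥'

  AllVars-∧ : ∀ {a b} → AllVars P a → AllVars P b → AllVars P (a ∧' b)
  AllVars-∧ ha hb = AllVars-¬ (ha ⇒ AllVars-¬ hb)

  AllVars-∨ : ∀ {a b} → AllVars P a → AllVars P b → AllVars P (a ∨' b)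
  AllVars-∨ ha hb = AllVars-¬ ha ⇒ hb

  AllVars-◇ : ∀ {a} → AllVars P a → AllVars P (◇' a)
  AllVars-◇ ha = AllVars-¬ (□ AllVars-¬ ha)

infixr 5 _⇒ˢ_
infixr 7 _∧ˢ_
infixr 6 _∨ˢ_

data Schema (n : ℕ) : Set where
  at   : Fin n → Schema n
  ⊥ˢ   : Schema n
  _⇒ˢ_ : Schema n → Schema n → Schema n

¬ˢ : Schema n → Schema n
¬ˢ f = f ⇒ˢ ⊥ˢ

_∧ˢ_ _∨ˢ_ : Schema n → Schema n → Schema n
f ∧ˢ g = ¬ˢ (f ⇒ˢ ¬ˢ g)
f ∨ˢ g = ¬ˢ f ⇒ˢ g

α : Schema (1 + n)
α = at zero

β : Schema (2 + n)
β = at (suc zero)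

γ : Schema (3 + n)
γ = at (suc (suc zero))

δ : Schema (4 + n)
δ = at (suc (suc (suc zero)))

⟦_⟧ : Schema n → Vec Fm n → Fm
⟦ at i ⟧ ρ = lookup ρ i
⟦ ⊥ˢ ⟧ ρ = ⊥'
⟦ f ⇒ˢ g ⟧ ρ = ⟦ f ⟧ ρ ⇒ ⟦ g ⟧ ρ

truth : Vec Bool n → Schema n → Bool
truth bs (at i) = lookup bs i
truth bs ⊥ˢ = false
truth bs (f ⇒ˢ g) = not (truth bs f) ∨ truth bs g

allRows : ∀ n → (Vec Bool n → Bool) → Bool
allRows zero    r = r []
allRows (suc n) r = allRows n (r ∘ (false ∷_)) ∧ allRows n (r ∘ (true ∷_))

allRows-sound : ∀ n r → T (allRows n r) → ∀ bs → T (r bs)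
allRows-sound zero    r h [] = h
allRows-sound (suc n) r h (false ∷ bs) = allRows-sound n _ (proj₁ (Equivalence.to T-∧ h)) bs
allRows-sound (suc n) r h (true ∷ bs) = allRows-sound n _ (proj₂ (Equivalence.to T-∧ h)) bs

Valid : Schema n → Set
Valid {n} f = T (allRows n (λ bs → truth bs f))

truth-⟦⟧ : ∀ V B (f : Schema n) ρ → eval V B (⟦ f ⟧ ρ) ≡ truth (Vec.map (eval V B) ρ) f
truth-⟦⟧ V B (at i) ρ = sym (lookup-map i (eval V B) ρ)
truth-⟦⟧ V B ⊥ˢ ρ = refl
truth-⟦⟧ V B (f ⇒ˢ g) ρ = cong₂ (λ x y → not x ∨ y) (truth-⟦⟧ V B f ρ) (truth-⟦⟧ V B g ρ)

Valid⇒Tautology : (f : Schema n) → Valid f → ∀ ρ → Tautology (⟦ f ⟧ ρ)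
Valid⇒Tautology {n} f valid ρ V B =
  trans (truth-⟦⟧ V B f ρ) (Equivalence.to T-≡ (allRows-sound n _ valid (Vec.map (eval V B) ρ)))

module DerivedRules {L : Logic} (L-normal : IsNormal L) where

  private module N = IsNormal L-normal

  infix 2 ⊢_
  ⊢_ : Fm → Set
  ⊢ φ = L ⊢ φ

  ⊢schema : (f : Schema n) → {{Valid f}} → (ρ : Vec Fm n) → ⊢ ⟦ f ⟧ ρ
  ⊢schema f {{valid}} ρ = N.taut _ (Valid⇒Tautology f valid ρ)

  ⇒-elim : ∀ {a b} → ⊢ a ⇒ b → ⊢ a → ⊢ b
  ⇒-elim = N.mp _ _

  ⇒-elim₂ : ∀ {a b c} → ⊢ a ⇒ b ⇒ c → ⊢ a → ⊢ b → ⊢ c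
  ⇒-elim₂ h ha hb = ⇒-elim (⇒-elim h ha) hb

  infixr 4 _⨾_
  _⨾_ : ∀ {a b c} → ⊢ a ⇒ b → ⊢ b ⇒ c → ⊢ a ⇒ c
  _⨾_ {a} {b} {c} = ⇒-elim₂ (⊢schema ((α ⇒ˢ β) ⇒ˢ (β ⇒ˢ γ) ⇒ˢ α ⇒ˢ γ) (a ∷ b ∷ c ∷ []))

  ⇒-∧ : ∀ {a b c} → ⊢ a ⇒ b → ⊢ a ⇒ c → ⊢ a ⇒ b ∧' c
  ⇒-∧ {a} {b} {c} = ⇒-elim₂ (⊢schema ((α ⇒ˢ β) ⇒ˢ (α ⇒ˢ γ) ⇒ˢ α ⇒ˢ β ∧ˢ γ) (a ∷ b ∷ c ∷ []))

  ⇒-mp : ∀ {a b c} → ⊢ a ⇒ b ⇒ c → ⊢ a ⇒ b → ⊢ a ⇒ c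
  ⇒-mp {a} {b} {c} = ⇒-elim₂ (⊢schema ((α ⇒ˢ β ⇒ˢ γ) ⇒ˢ (α ⇒ˢ β) ⇒ˢ α ⇒ˢ γ) (a ∷ b ∷ c ∷ []))

  ∧-proj₁ : ∀ {a b} → ⊢ a ∧' b ⇒ a
  ∧-proj₁ {a} {b} = ⊢schema (α ∧ˢ β ⇒ˢ α) (a ∷ b ∷ [])

  ∧-proj₂ : ∀ {a b} → ⊢ a ∧' b ⇒ b
  ∧-proj₂ {a} {b} = ⊢schema (α ∧ˢ β ⇒ˢ β) (a ∷ b ∷ [])

  ⇒-uncurry : ∀ {a b c} → ⊢ a ⇒ b ⇒ c → ⊢ a ∧' b ⇒ c
  ⇒-uncurry {a} {b} {c} = ⇒-elim (⊢schema ((α ⇒ˢ β ⇒ˢ γ) ⇒ˢ α ∧ˢ β ⇒ˢ γ) (a ∷ b ∷ c ∷ []))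

  contrapose : ∀ {a b} → ⊢ a ⇒ b → ⊢ ¬' b ⇒ ¬' a
  contrapose {a} {b} = ⇒-elim (⊢schema ((α ⇒ˢ β) ⇒ˢ ¬ˢ β ⇒ˢ ¬ˢ α) (a ∷ b ∷ []))

  ⇒-cases : ∀ {a ℓ b c} → ⊢ a ∧' ℓ ⇒ b → ⊢ a ∧' ¬' ℓ ⇒ c → ⊢ a ⇒ ℓ ∧' b ∨' ¬' ℓ ∧' c
  ⇒-cases {a} {ℓ} {b} {c} = ⇒-elim₂
    (⊢schema ((α ∧ˢ β ⇒ˢ γ) ⇒ˢ (α ∧ˢ ¬ˢ β ⇒ˢ δ) ⇒ˢ α ⇒ˢ β ∧ˢ γ ∨ˢ ¬ˢ β ∧ˢ δ) (a ∷ ℓ ∷ b ∷ c ∷ []))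

  □-K : ∀ {a b} → ⊢ □ (a ⇒ b) ⇒ □ a ⇒ □ b
  □-K {a} {b} = N.usubst (pq≔ a b) axK N.K

  □-mono : ∀ {a b} → ⊢ a ⇒ b → ⊢ □ a ⇒ □ b
  □-mono h = ⇒-elim □-K (N.nec _ h)

  □-mono₂ : ∀ {a b c} → ⊢ a ⇒ b ⇒ c → ⊢ □ a ⇒ □ b ⇒ □ c
  □-mono₂ h = □-mono h ⨾ □-K

  □-∧ : ∀ {a b} → ⊢ □ a ∧' □ b ⇒ □ (a ∧' b)
  □-∧ {a} {b} = ⇒-uncurry (□-mono₂ (⊢schema (α ⇒ˢ β ⇒ˢ α ∧ˢ β) (a ∷ b ∷ [])))

  ◇-mono : ∀ {a b} → ⊢ a ⇒ b → ⊢ ◇' a ⇒ ◇' b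
  ◇-mono h = contrapose (□-mono (contrapose h))

  □◇-∧ : ∀ {a b} → ⊢ □ b ∧' ◇' a ⇒ ◇' (a ∧' b)
  □◇-∧ {a} {b} = ⇒-elim
    (⊢schema ((α ⇒ˢ β ⇒ˢ γ) ⇒ˢ α ∧ˢ ¬ˢ γ ⇒ˢ ¬ˢ β) (□ b ∷ □ ¬' (a ∧' b) ∷ □ ¬' a ∷ []))
    (□-mono₂ (⊢schema (α ⇒ˢ ¬ˢ (β ∧ˢ α) ⇒ˢ ¬ˢ β) (b ∷ a ∷ [])))

-- Frames are finitely branching, so forcing is decidable; this is what lets a Boolean
-- tautology, in which boxed subformulas are atoms, be forced at every world.
module Kripke {W : Set} (succ : W → List W) where

  Valuation : Set
  Valuation = W → ℕ → Bool

  infix 4 _⊩⟨_⟩_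
  _⊩⟨_⟩_ : W → Valuation → Fm → Set
  w ⊩⟨ V ⟩ var x = T (V w x)
  w ⊩⟨ V ⟩ ⊥' = ⊥
  w ⊩⟨ V ⟩ (a ⇒ b) = w ⊩⟨ V ⟩ a → w ⊩⟨ V ⟩ b
  w ⊩⟨ V ⟩ (□ a) = All (λ v → v ⊩⟨ V ⟩ a) (succ w)

  ⊩? : ∀ w V φ → Dec (w ⊩⟨ V ⟩ φ)
  ⊩? w V (var x) = T? (V w x)
  ⊩? w V ⊥' = no λ ()
  ⊩? w V (a ⇒ b) = ⊩? w V a →-dec ⊩? w V b
  ⊩? w V (□ a) = All.all? (λ v → ⊩? v V a) (succ w)

  eval-⊩? : ∀ w V φ → eval (V w) (λ c → does (⊩? w V c)) φ ≡ does (⊩? w V φ)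
  eval-⊩? w V (var x) = refl
  eval-⊩? w V ⊥' = refl
  eval-⊩? w V (a ⇒ b) = cong₂ (λ x y → not x ∨ y) (eval-⊩? w V a) (eval-⊩? w V b)
  eval-⊩? w V (□ a) = refl

  Tautology⇒⊩ : ∀ {φ} → Tautology φ → ∀ V w → w ⊩⟨ V ⟩ φ
  Tautology⇒⊩ {φ} tautology V w = Equivalence.to (T-does (⊩? w V φ))
    (Equivalence.from T-≡ (trans (sym (eval-⊩? w V φ)) (tautology (V w) _)))

  infixl 5 _⊚_
  _⊚_ : Valuation → (ℕ → Fm) → Valuation
  (V ⊚ σ) w x = does (⊩? w V (σ x))

  ⊩-subst : ∀ σ φ {V w} → w ⊩⟨ V ⟩ subst σ φ ⇔ w ⊩⟨ V ⊚ σ ⟩ φ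
  ⊩-subst σ (var x) {V} {w} = ⇔.sym (T-does (⊩? w V (σ x)))
  ⊩-subst σ ⊥' = ⇔.refl
  ⊩-subst σ (a ⇒ b) = →-cong-⇔ (⊩-subst σ a) (⊩-subst σ b)
  ⊩-subst σ (□ a) = All-cong-⇔ (⊩-subst σ a)

  ⊮-◇ : ∀ {V w a} → (∀ {v} → v ∈ succ w → ¬ (v ⊩⟨ V ⟩ a)) → ¬ (w ⊩⟨ V ⟩ ◇' a)
  ⊮-◇ h ◇a = ◇a (All.tabulate h)

  module _ (reflexive : ∀ w → w ∈ succ w)
           (transitive : ∀ w {v u} → v ∈ succ w → u ∈ succ v → u ∈ succ w) where

    S4-sound : ∀ {φ} → S4 ⊢ φ → ∀ V w → w ⊩⟨ V ⟩ φ
    S4-sound (taut φ tautology) = Tautology⇒⊩ {φ} tautology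
    S4-sound K V w = λ □a⇒b □a → All.zipWith (λ (f , x) → f x) (□a⇒b , □a)
    S4-sound (ax _ t) V w = λ □a → All.lookup □a (reflexive w)
    S4-sound (ax _ four) V w = λ □a →
      All.tabulate λ v∈ → All.tabulate λ u∈ → All.lookup □a (transitive w v∈ u∈)
    S4-sound (mp _ _ ⊢a⇒b ⊢a) V w = S4-sound ⊢a⇒b V w (S4-sound ⊢a V w)
    S4-sound (nec _ ⊢a) V w = All.tabulate λ _ → S4-sound ⊢a V _
    S4-sound (usubst σ φ ⊢φ) V w = Equivalence.from (⊩-subst σ φ) (S4-sound ⊢φ (V ⊚ σ) w)

  module Bisimulation (V : Valuation) (P : ℕ → Set) where

    Agree : W → W → Set
    Agree w w' = ∀ {x} → P x → V w x ≡ V w' x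

    Bisimilar : ℕ → W → W → Set
    Bisimilar zero    w w' = Agree w w'
    Bisimilar (suc k) w w' = Agree w w'
      × (∀ {v} → v ∈ succ w → ∃[ v' ] v' ∈ succ w' × Bisimilar k v v')
      × (∀ {v'} → v' ∈ succ w' → ∃[ v ] v ∈ succ w × Bisimilar k v v')

    Bisimilar⇒Agree : ∀ k {w w'} → Bisimilar k w w' → Agree w w'
    Bisimilar⇒Agree zero    agree = agree
    Bisimilar⇒Agree (suc k) (agree , _) = agree

    Bisimilar-refl : ∀ k w → Bisimilar k w w
    Bisimilar-refl zero    w = λ _ → refl
    Bisimilar-refl (suc k) w = (λ _ → refl) ,
      (λ {v} v∈ → v , v∈ , Bisimilar-refl k v) , (λ {v} v∈ → v , v∈ , Bisimilar-refl k v)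

    ⊩-invariant : ∀ {k w w'} θ → depth θ ≤ k → AllVars P θ → Bisimilar k w w' →
                  w ⊩⟨ V ⟩ θ ⇔ w' ⊩⟨ V ⟩ θ
    ⊩-invariant {k} (var x) _ (var Px) bisim = mk⇔ (≡.subst T agree) (≡.subst T (sym agree))
      where agree = Bisimilar⇒Agree k bisim Px
    ⊩-invariant ⊥' _ _ _ = ⇔.refl
    ⊩-invariant (a ⇒ b) ≤k (va ⇒ vb) bisim = →-cong-⇔
      (⊩-invariant a (m⊔n≤o⇒m≤o (depth a) (depth b) ≤k) va bisim)
      (⊩-invariant b (m⊔n≤o⇒n≤o (depth a) (depth b) ≤k) vb bisim)
    ⊩-invariant (□ a) (s≤s ≤k) (□ va) (_ , zig , zag) = mk⇔
      (λ □a → All.tabulate λ v'∈ → let v , v∈ , bisim = zag v'∈ in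
        Equivalence.to (⊩-invariant a ≤k va bisim) (All.lookup □a v∈))
      (λ □a → All.tabulate λ v∈ → let v' , v'∈ , bisim = zig v∈ in
        Equivalence.from (⊩-invariant a ≤k va bisim) (All.lookup □a v'∈))

K+-normal : ∀ X → IsNormal (K+ X)
K+-normal X = record { taut = taut ; K = K ; mp = mp ; nec = nec ; usubst = usubst }

K+-mono : ∀ {X Y} → (∀ φ → X φ → K+ Y φ) → K+ X ⊆ K+ Y
K+-mono X⊆Y φ (taut _ tautology) = taut φ tautology
K+-mono X⊆Y _ K = K
K+-mono X⊆Y φ (ax _ Xφ) = X⊆Y φ Xφ
K+-mono X⊆Y φ (mp a _ ⊢a⇒φ ⊢a) = mp a φ (K+-mono X⊆Y _ ⊢a⇒φ) (K+-mono X⊆Y a ⊢a)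
K+-mono X⊆Y _ (nec a ⊢a) = nec a (K+-mono X⊆Y a ⊢a)
K+-mono X⊆Y _ (usubst σ a ⊢a) = usubst σ a (K+-mono X⊆Y a ⊢a)

⊆-refl : ∀ {L} → L ⊆ L
⊆-refl _ ⊢φ = ⊢φ

K4⊆KD4 : K4 ⊆ KD4
K4⊆KD4 = K+-mono λ { _ four → ax _ four }

K4⊆S4 : K4 ⊆ S4
K4⊆S4 = K+-mono λ { _ four → ax _ four }

KD4⊆S4 : KD4 ⊆ S4
KD4⊆S4 = K+-mono λ { _ d → usubst (λ _ → ⊥') axT (ax _ t) ; _ four → ax _ four }

X Y φ₀ : Fm
X = (p ∧' q ⇒ ◇' (p ∧' ¬' q)) ∧' (p ∧' ¬' q ⇒ ◇' (p ∧' q))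
Y = X ∧' □ X
φ₀ = p ∧' Y

Alt : ℕ → Fm
Alt zero    = ⊤'
Alt (suc n) = q ∧' ◇' (¬' q ∧' Alt n) ∨' ¬' q ∧' ◇' (q ∧' Alt n)

Alt-vars : ∀ n → AllVars (_≡ 1) (Alt n)
Alt-vars zero    = ⊥' ⇒ ⊥'
Alt-vars (suc n) =
  AllVars-∨ (AllVars-∧ q-var (AllVars-◇ (AllVars-∧ (AllVars-¬ q-var) (Alt-vars n))))
            (AllVars-∧ (AllVars-¬ q-var) (AllVars-◇ (AllVars-∧ q-var (Alt-vars n))))
  where q-var = var refl

module _ where
  open DerivedRules (K+-normal X-K4)

  □-4 : ∀ {a} → ⊢ □ a ⇒ □ □ a
  □-4 {a} = usubst (pq≔ a a) ax4 (ax ax4 four)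

  Y⇒□Y : ⊢ Y ⇒ □ Y
  Y⇒□Y = ⇒-∧ ∧-proj₂ (∧-proj₂ ⨾ □-4) ⨾ □-∧

  φ₀∧ℓ⇒p∧ℓ : ∀ {ℓ} → ⊢ φ₀ ∧' ℓ ⇒ p ∧' ℓ
  φ₀∧ℓ⇒p∧ℓ = ⇒-∧ (∧-proj₁ ⨾ ∧-proj₁) ∧-proj₂

  φ₀∧ℓ⇒X : ∀ {ℓ} → ⊢ φ₀ ∧' ℓ ⇒ X
  φ₀∧ℓ⇒X = ∧-proj₁ ⨾ ∧-proj₂ ⨾ ∧-proj₁

  φ₀∧q⇒◇¬q : ⊢ φ₀ ∧' q ⇒ ◇' (p ∧' ¬' q)
  φ₀∧q⇒◇¬q = ⇒-mp (φ₀∧ℓ⇒X ⨾ ∧-proj₁) φ₀∧ℓ⇒p∧ℓ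

  φ₀∧¬q⇒◇q : ⊢ φ₀ ∧' ¬' q ⇒ ◇' (p ∧' q)
  φ₀∧¬q⇒◇q = ⇒-mp (φ₀∧ℓ⇒X ⨾ ∧-proj₂) φ₀∧ℓ⇒p∧ℓ

  -- Y is inherited by successors (by 4), so a p-successor of a φ₀-world is again a φ₀-world.
  ◇-step : ∀ {ℓ ℓ̄ a} → ⊢ φ₀ ⇒ a → ⊢ φ₀ ∧' ℓ ⇒ ◇' (p ∧' ℓ̄) → ⊢ φ₀ ∧' ℓ ⇒ ◇' (ℓ̄ ∧' a)
  ◇-step φ₀⇒a φ₀∧ℓ⇒◇ℓ̄ =
    ⇒-∧ (∧-proj₁ ⨾ ∧-proj₂ ⨾ Y⇒□Y) φ₀∧ℓ⇒◇ℓ̄ ⨾ □◇-∧ ⨾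
    ◇-mono (⇒-∧ (∧-proj₁ ⨾ ∧-proj₂) (⇒-∧ (∧-proj₁ ⨾ ∧-proj₁) ∧-proj₂ ⨾ φ₀⇒a))

  φ₀⇒Alt : ∀ n → ⊢ φ₀ ⇒ Alt n
  φ₀⇒Alt zero    = ⊢schema (α ⇒ˢ ¬ˢ ⊥ˢ) (φ₀ ∷ [])
  φ₀⇒Alt (suc n) = ⇒-cases (◇-step (φ₀⇒Alt n) φ₀∧q⇒◇¬q) (◇-step (φ₀⇒Alt n) φ₀∧¬q⇒◇q)

parity : ℕ → Bool
parity zero    = true
parity (suc n) = not (parity n)

parity-hits : ∀ i b → ∃[ j ] i ≤ j × j ≤ suc i × parity j ≡ b
parity-hits i b with parity i ≟ᵇ b
... | yes parity≡b = i , ≤-refl , n≤1+n i , parity≡b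
... | no  parity≢b = suc i , n≤1+n i , ≤-refl , sym (¬-not (parity≢b ∘ sym))

data World : Set where
  chain   : ℕ → World
  cluster : ℕ → Bool → World

height : World → ℕ
height (chain i)     = i
height (cluster m _) = m

chainUpTo : ℕ → List World
chainUpTo i = map chain (downFrom (suc i))

succ : World → List World
succ (chain i)     = chainUpTo i
succ (cluster m b) = cluster m true ∷ cluster m false ∷ chainUpTo m

val : World → ℕ → Bool
val (chain i)     0 = false
val (chain i)     1 = parity i
val (cluster m b) 0 = true
val (cluster m b) 1 = b
val _ (suc (suc _)) = false

colour : World → Bool
colour w = val w 1

chain∈chainUpTo : ∀ {i j} → j ≤ i → chain j ∈ chainUpTo i
chain∈chainUpTo j≤i = ∈-map⁺ chain (∈-downFrom⁺ (s≤s j≤i))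

∈chainUpTo⇒chain : ∀ {i v} → v ∈ chainUpTo i → ∃[ j ] j ≤ i × v ≡ chain j
∈chainUpTo⇒chain v∈ with ∈-map⁻ chain v∈
... | j , j∈ , refl = j , ≤-pred (∈-downFrom⁻ j∈) , refl

chain∈succ : ∀ w {j} → j ≤ height w → chain j ∈ succ w
chain∈succ (chain i)     j≤i = chain∈chainUpTo j≤i
chain∈succ (cluster m b) j≤m = there (there (chain∈chainUpTo j≤m))

succ-refl : ∀ w → w ∈ succ w
succ-refl (chain i)         = chain∈chainUpTo ≤-refl
succ-refl (cluster m true)  = here refl
succ-refl (cluster m false) = there (here refl)

succ-trans : ∀ w {v u} → v ∈ succ w → u ∈ succ v → u ∈ succ w
succ-trans (chain i) v∈ u∈ with ∈chainUpTo⇒chain v∈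
... | j , j≤i , refl with ∈chainUpTo⇒chain u∈
...   | k , k≤j , refl = chain∈chainUpTo (≤-trans k≤j j≤i)
succ-trans (cluster m b) (here refl)         u∈ = u∈
succ-trans (cluster m b) (there (here refl)) u∈ = u∈
succ-trans (cluster m b) (there (there v∈))  u∈ = there (there (succ-trans (chain m) v∈ u∈))

successor-shallow-or-high : ∀ {k} w {v} → suc k ≤ height w → v ∈ succ w →
                            k ≤ height v ⊎ ∃[ j ] j < k × v ≡ chain j
successor-shallow-or-high {k} (chain i) _ v∈ with ∈chainUpTo⇒chain v∈
... | j , _ , refl with j <? k
...   | yes j<k = inj₂ (j , j<k , refl)
...   | no  j≮k = inj₁ (≮⇒≥ j≮k)
successor-shallow-or-high (cluster m b) k<m (here refl)         = inj₁ (<⇒≤ k<m)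
successor-shallow-or-high (cluster m b) k<m (there (here refl)) = inj₁ (<⇒≤ k<m)
successor-shallow-or-high (cluster m b) k<m (there (there v∈))  =
  successor-shallow-or-high (chain m) k<m v∈

high-successor : ∀ {k} w → suc k ≤ height w → ∀ b → ∃[ v ] v ∈ succ w × k ≤ height v × colour v ≡ b
high-successor (chain (suc i)) (s≤s k≤i) b with parity-hits i b
... | j , i≤j , j≤1+i , parity≡b = chain j , chain∈chainUpTo j≤1+i , ≤-trans k≤i i≤j , parity≡b
high-successor (cluster m _) k<m true  = cluster m true , here refl , <⇒≤ k<m , refl
high-successor (cluster m _) k<m false = cluster m false , there (here refl) , <⇒≤ k<m , refl

open Kripke succ
open Bisimulation val (_≡ 1)

agree : ∀ w w' → colour w ≡ colour w' → Agree w w'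
agree _ _ same refl = same

high-bisimilar : ∀ {k} w w' → k ≤ height w → k ≤ height w' → colour w ≡ colour w' → Bisimilar k w w'
high-bisimilar {zero}  w w' _  _   same = agree w w' same
high-bisimilar {suc k} w w' hw hw' same = agree w w' same , zig , zag
  where
  zig : ∀ {v} → v ∈ succ w → ∃[ v' ] v' ∈ succ w' × Bisimilar k v v'
  zig {v} v∈ with successor-shallow-or-high w hw v∈
  ... | inj₂ (j , j<k , refl) =
    chain j , chain∈succ w' (≤-trans (<⇒≤ j<k) (<⇒≤ hw')) , Bisimilar-refl k (chain j)
  ... | inj₁ hv with high-successor w' hw' (colour v)
  ...   | v' , v'∈ , hv' , same' = v' , v'∈ , high-bisimilar v v' hv hv' (sym same')

  zag : ∀ {v'} → v' ∈ succ w' → ∃[ v ] v ∈ succ w × Bisimilar k v v'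
  zag {v'} v'∈ with successor-shallow-or-high w' hw' v'∈
  ... | inj₂ (j , j<k , refl) =
    chain j , chain∈succ w (≤-trans (<⇒≤ j<k) (<⇒≤ hw)) , Bisimilar-refl k (chain j)
  ... | inj₁ hv' with high-successor w hw (colour v')
  ...   | v , v∈ , hv , same' = v , v∈ , high-bisimilar v v' hv hv' same'

infix 4 _⊩_
_⊩_ : World → Fm → Set
w ⊩ φ = w ⊩⟨ val ⟩ φ

-- ∧' and ◇' are double negations: to force them, refute a refutation.
X-everywhere : ∀ w → w ⊩ X
X-everywhere (chain i) clauses = clauses (λ p∧q → ⊥-elim (p∧q λ ())) (λ p∧¬q → ⊥-elim (p∧¬q λ ()))
X-everywhere (cluster m b) clauses = clauses
  (λ _ □¬[p∧¬q] → All.lookup □¬[p∧¬q] (there (here refl)) λ p⇒q → p⇒q _ λ ())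
  (λ _ □¬[p∧q] → All.lookup □¬[p∧q] (here refl) λ p⇒¬q → p⇒¬q _ _)

φ₀-on-clusters : ∀ m b → cluster m b ⊩ φ₀
φ₀-on-clusters m b p⇒¬Y = p⇒¬Y _ λ X⇒¬□X →
  X⇒¬□X (X-everywhere (cluster m b)) (All.tabulate λ {v} _ → X-everywhere v)

⊮-ℓ∧◇ℓ̄ : ∀ {i ℓ ℓ̄ a} → (∀ {w} → w ⊩ ℓ → ¬ w ⊩ ℓ̄) → (∀ {j} → j < i → ¬ chain j ⊩ a) →
         ¬ chain i ⊩ ℓ ∧' ◇' (ℓ̄ ∧' a)
⊮-ℓ∧◇ℓ̄ {i} {ℓ} {ℓ̄} {a} opposite below ℓ∧◇ =
  ℓ∧◇ λ ℓ-holds → ⊮-◇ {val} {chain i} {ℓ̄ ∧' a} (refute ℓ-holds)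
  where
  refute : chain i ⊩ ℓ → ∀ {v} → v ∈ succ (chain i) → ¬ v ⊩ ℓ̄ ∧' a
  refute ℓ-holds v∈ ℓ̄∧a with ∈chainUpTo⇒chain v∈
  ... | j , j≤i , refl = ℓ̄∧a λ ℓ̄-holds a-holds →
    [ (λ j<i → below j<i a-holds) , (λ { refl → opposite ℓ-holds ℓ̄-holds }) ] (m≤n⇒m<n∨m≡n j≤i)

Alt-fails-on-chain : ∀ n {i} → i < n → ¬ chain i ⊩ Alt n
Alt-fails-on-chain (suc n) {i} (s≤s i≤n) alt = ⊮-¬q (alt ⊮-q)
  where
  below : ∀ {j} → j < i → ¬ chain j ⊩ Alt n
  below j<i = Alt-fails-on-chain n (≤-trans j<i i≤n)
  ⊮-q : ¬ chain i ⊩ q ∧' ◇' (¬' q ∧' Alt n)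
  ⊮-q = ⊮-ℓ∧◇ℓ̄ {ℓ = q} {¬' q} {Alt n} (λ q-holds ¬q-holds → ¬q-holds q-holds) below
  ⊮-¬q : ¬ chain i ⊩ ¬' q ∧' ◇' (q ∧' Alt n)
  ⊮-¬q = ⊮-ℓ∧◇ℓ̄ {ℓ = ¬' q} {q} {Alt n} (λ ¬q-holds q-holds → ¬q-holds q-holds) below

S4⇒⊩ : ∀ {φ} → S4 ⊢ φ → ∀ w → w ⊩ φ
S4⇒⊩ ⊢φ = S4-sound succ-refl succ-trans ⊢φ val

≤1∧∉[0]⇒≡1 : ∀ {x} → x ≤ 1 → x ∉ 0 ∷ [] → x ≡ 1
≤1∧∉[0]⇒≡1 {0}           _         x∉ = ⊥-elim (x∉ (here refl))
≤1∧∉[0]⇒≡1 {1}           _         _  = refl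
≤1∧∉[0]⇒≡1 {suc (suc _)} (s≤s ()) _

≡1⇒∉[0] : ∀ {x} → x ≡ 1 → x ∉ 0 ∷ []
≡1⇒∉[0] refl (here ())

no-ULIP-between-K4-and-S4 : ∀ {L} → K4 ⊆ L → L ⊆ S4 → ¬ ULIP L
no-ULIP-between-K4-and-S4 {L} K4⊆L L⊆S4 ulip with ulip φ₀ (0 ∷ []) (0 ∷ [])
... | θ , θ⁺ , θ⁻ , ⊢φ₀⇒θ , θ-uniform =
  Alt-fails-on-chain (suc k) ≤-refl (S4⇒⊩ (L⊆S4 _ ⊢θ⇒Alt) (chain k) θ-on-chain)
  where
  k = depth θ

  φ₀-vars : AllVars (_≤ 1) φ₀
  φ₀-vars = from-yes (allVars? (_≤? 1) φ₀)

  θ-vars : AllVars (_≡ 1) θ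
  θ-vars = occurrences⇒AllVars θ
    (λ {x} x∈ → let x∈φ₀ , x∉ = θ⁺ x x∈ in ≤1∧∉[0]⇒≡1 (AllVars-v⁺ φ₀-vars x∈φ₀) x∉)
    (λ {x} x∈ → let x∈φ₀ , x∉ = θ⁻ x x∈ in ≤1∧∉[0]⇒≡1 (AllVars-v⁻ φ₀-vars x∈φ₀) x∉)

  θ-on-chain : chain k ⊩ θ
  θ-on-chain = Equivalence.to
    (⊩-invariant θ ≤-refl θ-vars (high-bisimilar w (chain k) ≤-refl ≤-refl refl))
    (S4⇒⊩ (L⊆S4 _ ⊢φ₀⇒θ) w (φ₀-on-clusters k (parity k)))
    where w = cluster k (parity k)

  ⊢θ⇒Alt : L ⊢ (θ ⇒ Alt (suc k))
  ⊢θ⇒Alt = θ-uniform (Alt (suc k))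
    (λ _ x∈ → ≡1⇒∉[0] (AllVars-v⁺ (Alt-vars (suc k)) x∈))
    (λ _ x∈ → ≡1⇒∉[0] (AllVars-v⁻ (Alt-vars (suc k)) x∈))
    (K4⊆L _ (φ₀⇒Alt (suc k)))

corollary2p11 : (¬ ULIP K4) × (¬ ULIP KD4) × (¬ ULIP S4) ×
                  ((L : Logic) → IsNormal L → K4 ⊆ L → L ⊆ S4 → ¬ ULIP L)
corollary2p11 =
  no-ULIP-between-K4-and-S4 ⊆-refl K4⊆S4 ,
  no-ULIP-between-K4-and-S4 K4⊆KD4 KD4⊆S4 ,
  no-ULIP-between-K4-and-S4 K4⊆S4 ⊆-refl ,
  λ L _ → no-ULIP-between-K4-and-S4
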